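{- For $m\ge 3$ and $n\ge 3$, writing $n=3k$, $3k+1$ or $3k+2$ with $k$ a positive integer, $$\gamma(P_n\times K_m)\le \begin{cases} 2k+1, & n=3k;\\ 2k+2, & n=3k+1 \text{ or } n=3k+2.\end{cases}$$
   Context: $P_n$ is the path on $\{1,\dots,n\}$ with edges $\{i,i+1\}$, $1\le i\le n-1$; $K_m$ is the complete graph on $\{1,\dots,m\}$. The direct product $G\times H$ has vertex set $V(G)\times V(H)$ with $(g_1,h_1)\sim(g_2,h_2)$ iff $g_1g_2\in E(G)$ and $h_1h_2\in E(H)$. $\gamma(G)$ denotes the domination number: the minimum size of a set $D$ of vertices such that every vertex not in $D$ is adjacent to a vertex of $D$. -}

module Defs where

open import Data.Nat using (ℕ; suc; _+_; _*_; _≤_)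
open import Data.Fin using (Fin; toℕ)
open import Data.Product using (_×_; _,_; Σ; ∃-syntax)
open import Data.Sum using (_⊎_)
open import Data.List using (List; length)
open import Data.List.Membership.Propositional using (_∈_)
open import Relation.Binary.PropositionalEquality using (_≡_; _≢_)
open import Relation.Nullary using (¬_)

record Graph : Set₁ where
  field
    V   : Set
    Adj : V → V → Set
open Graph public

-- The path P_n on vertices 1..n, encoded as Fin n (vertex i ↔ toℕ i + 1);
-- edges {i, i+1}.
P : ℕ → Graph
P n = record { V = Fin n ; Adj = λ i j → (suc (toℕ i) ≡ toℕ j) ⊎ (suc (toℕ j) ≡ toℕ i) }

K : ℕ → Graph
K m = record { V = Fin m ; Adj = λ i j → i ≢ j }

_×ᴳ_ : Graph → Graph → Graph
G ×ᴳ H = record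
  { V   = V G × V H
  ; Adj = λ { (g₁ , h₁) (g₂ , h₂) → Adj G g₁ g₂ × Adj H h₁ h₂ } }

Dominating : (G : Graph) → List (V G) → Set
Dominating G D = ∀ v → v ∈ D ⊎ (∃[ u ] (u ∈ D × Adj G v u))

-- γ(G) ≤ b : there is a dominating set with at most b elements.
-- (A list may contain repetitions; removing them only shortens it,
-- so this is equivalent to the existence of a dominating set of size ≤ b.)
γ≤ : Graph → ℕ → Set
γ≤ G b = ∃[ D ] (Dominating G D × length D ≤ b)

{-# OPTIONS --safe #-}
-- Fix two distinct colours a and b. On P_(3j+2) × K_m take the vertices
-- (3i, cᵢ) and (3i+1, cᵢ) for i ≤ j, where the colours cᵢ alternate between a and b.
-- A vertex (t, c) in such a row is chosen if c = cᵢ and is otherwise adjacent to the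
-- partner vertex in the other row of the pair; a vertex in a gap row 3i+2 with
-- c ≠ cᵢ is adjacent to (3i+1, cᵢ), and with c = cᵢ to (3i+3, cᵢ₊₁) since cᵢ₊₁ ≠ cᵢ.
-- This gives 2j+2 vertices. For n = 3k prepend one row holding (0, a), for n = 3k+1
-- two rows with (1, a) and (1, b). Only two colours are used, so m ≥ 2 suffices.
module Submission where

open import Defs
open import Data.Nat using (ℕ; zero; suc; _+_; _*_; _≤_; _<_; z≤n; s≤s; NonZero)
open import Data.Nat.Properties using (+-suc; +-comm; *-comm; +-monoʳ-<; ≤-reflexive)
open import Data.Nat.DivMod using (_mod_; m<n⇒m%n≡m)
open import Data.Fin using (Fin; toℕ) renaming (zero to fzero; suc to fsuc)
open import Data.Fin.Properties using (_≟_; toℕ<n; toℕ-injective; toℕ-fromℕ<)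
open import Data.Product using (_×_; _,_; proj₁; Σ-syntax)
open import Data.Sum using (_⊎_; inj₁; inj₂)
import Data.Sum as Sum
open import Data.List using (List; []; _∷_; map; length)
open import Data.List.Properties using (length-map)
open import Data.List.Membership.Propositional using (_∈_)
open import Data.List.Membership.Propositional.Properties using (∈-map⁺)
open import Data.List.Relation.Unary.Any using (here; there)
open import Function using (_∘_)
open import Relation.Binary.PropositionalEquality using (_≡_; _≢_; refl; sym; trans; cong; subst)
open import Relation.Nullary using (yes; no)

Pℕ : Graph
Pℕ = record { V = ℕ ; Adj = λ t s → (suc t ≡ s) ⊎ (suc s ≡ t) }

Pℕ-adj-+ : ∀ k {t s} → Adj Pℕ t s → Adj Pℕ (k + t) (k + s)
Pℕ-adj-+ k {t} {s} = Sum.map (λ e → trans (sym (+-suc k t)) (cong (k +_) e))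
                             (λ e → trans (sym (+-suc k s)) (cong (k +_) e))

d*k+r≡r+k*d : ∀ d k r → d * k + r ≡ r + k * d
d*k+r≡r+k*d d k r = trans (+-comm (d * k) r) (cong (r +_) (*-comm d k))

module _ {m : ℕ} where

  shift : ℕ → ℕ × Fin m → ℕ × Fin m
  shift k (t , c) = (k + t , c)

  -- Rows are indexed by ℕ so that patterns can be translated; the bound N records
  -- that every dominating vertex actually used is a vertex of P N × K m.
  DominatesBelow : ℕ → List (ℕ × Fin m) → ℕ × Fin m → Set
  DominatesBelow N L v = v ∈ L ⊎ Σ[ u ∈ ℕ × Fin m ] (u ∈ L × Adj (Pℕ ×ᴳ K m) v u × proj₁ u < N)

  dominatesBelow-∷⁺ : ∀ {N L u v} → DominatesBelow N L v → DominatesBelow N (u ∷ L) v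
  dominatesBelow-∷⁺ (inj₁ v∈L) = inj₁ (there v∈L)
  dominatesBelow-∷⁺ (inj₂ (w , w∈L , v~w , w<N)) = inj₂ (w , there w∈L , v~w , w<N)

  dominatesBelow-shift : ∀ k {N L t c} → DominatesBelow N L (t , c) →
                         DominatesBelow (k + N) (map (shift k) L) (k + t , c)
  dominatesBelow-shift k (inj₁ v∈L) = inj₁ (∈-map⁺ (shift k) v∈L)
  dominatesBelow-shift k (inj₂ ((s , a) , w∈L , (t~s , c≢a) , s<N)) =
    inj₂ ((k + s , a) , ∈-map⁺ (shift k) w∈L , (Pℕ-adj-+ k t~s , c≢a) , +-monoʳ-< k s<N)

  toℕ-mod : ∀ {s N} .{{_ : NonZero N}} → s < N → toℕ (s mod N) ≡ s
  toℕ-mod s<N = trans (toℕ-fromℕ< _) (m<n⇒m%n≡m s<N)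

  γ≤-dominatesBelow : ∀ {N} .{{_ : NonZero N}} (L : List (ℕ × Fin m)) →
                      (∀ t c → t < N → DominatesBelow N L (t , c)) →
                      γ≤ (P N ×ᴳ K m) (length L)
  γ≤-dominatesBelow {N} L below = map toFin L , dominating , ≤-length
    where
      -- mod N is just a total ℕ → Fin N; it is the identity on every row below N.
      toFin : ℕ × Fin m → Fin N × Fin m
      toFin (s , a) = (s mod N , a)

      dominating : Dominating (P N ×ᴳ K m) (map toFin L)
      dominating (i , c) with below (toℕ i) c (toℕ<n i)
      ... | inj₁ v∈L = inj₁ (subst (λ j → (j , c) ∈ map toFin L)
                                   (toℕ-injective (toℕ-mod (toℕ<n i))) (∈-map⁺ toFin v∈L))
      ... | inj₂ ((s , a) , w∈L , (i~s , c≢a) , s<N) =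
        inj₂ (toFin (s , a) , ∈-map⁺ toFin w∈L ,
              (subst (Adj Pℕ (toℕ i)) (sym (toℕ-mod s<N)) i~s , c≢a))

      ≤-length : length (map toFin L) ≤ length L
      ≤-length = ≤-reflexive (length-map toFin L)

  blocks : Fin m → Fin m → ℕ → List (ℕ × Fin m)
  blocks a b zero    = []
  blocks a b (suc j) = (0 , a) ∷ (1 , a) ∷ map (shift 3) (blocks b a j)

  length-blocks : ∀ a b j → length (blocks a b (suc j)) ≡ 2 + j * 2
  length-blocks a b zero    = refl
  length-blocks a b (suc j) =
    cong (2 +_) (trans (length-map (shift 3) (blocks b a (suc j))) (length-blocks b a j))

  -- Sizes are written r + j * 3 so that the step from j to suc j unfolds definitionally.
  blocks-dominatesBelow : ∀ {a b} → a ≢ b → ∀ j {t} c → t < 2 + j * 3 →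
                          DominatesBelow (2 + j * 3) (blocks a b (suc j)) (t , c)
  blocks-dominatesBelow {a} a≢b j {0} c _ with c ≟ a
  ... | yes refl = inj₁ (here refl)
  ... | no c≢a   = inj₂ ((1 , a) , there (here refl) , (inj₁ refl , c≢a) , s≤s (s≤s z≤n))
  blocks-dominatesBelow {a} a≢b j {1} c _ with c ≟ a
  ... | yes refl = inj₁ (there (here refl))
  ... | no c≢a   = inj₂ ((0 , a) , here refl , (inj₂ refl , c≢a) , s≤s z≤n)
  blocks-dominatesBelow a≢b zero {2} c (s≤s (s≤s ()))
  blocks-dominatesBelow {a} {b} a≢b (suc j) {2} c _ with c ≟ a
  ... | yes refl = inj₂ ((3 , b) , there (there (here refl)) , (inj₁ refl , a≢b) ,
                         s≤s (s≤s (s≤s (s≤s z≤n))))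
  ... | no c≢a   = inj₂ ((1 , a) , there (here refl) , (inj₂ refl , c≢a) , s≤s (s≤s z≤n))
  blocks-dominatesBelow a≢b zero {suc (suc (suc t))} c (s≤s (s≤s ()))
  blocks-dominatesBelow a≢b (suc j) {suc (suc (suc t))} c (s≤s (s≤s (s≤s t<))) =
    dominatesBelow-∷⁺ (dominatesBelow-∷⁺
      (dominatesBelow-shift 3 (blocks-dominatesBelow (a≢b ∘ sym) j c t<)))

  γ≤-P[2+3k]×K : ∀ {a b} → a ≢ b → ∀ k → γ≤ (P (2 + k * 3) ×ᴳ K m) (2 + k * 2)
  γ≤-P[2+3k]×K {a} {b} a≢b k =
    subst (γ≤ _) (length-blocks a b k)
      (γ≤-dominatesBelow (blocks a b (suc k)) (λ t c → blocks-dominatesBelow a≢b k c))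

  γ≤-P[3+3k]×K : ∀ {a b} → a ≢ b → ∀ k → γ≤ (P (3 + k * 3) ×ᴳ K m) (3 + k * 2)
  γ≤-P[3+3k]×K {a} {b} a≢b k =
    subst (γ≤ _) (cong suc (trans (length-map (shift 1) B) (length-blocks a b k)))
      (γ≤-dominatesBelow ((0 , a) ∷ map (shift 1) B) below)
    where
      B = blocks a b (suc k)
      below : ∀ t c → t < 3 + k * 3 →
              DominatesBelow (3 + k * 3) ((0 , a) ∷ map (shift 1) B) (t , c)
      below 0 c _ with c ≟ a
      ... | yes refl = inj₁ (here refl)
      ... | no c≢a   = inj₂ ((1 , a) , there (here refl) , (inj₁ refl , c≢a) , s≤s (s≤s z≤n))
      below (suc t) c (s≤s t<) =
        dominatesBelow-∷⁺ (dominatesBelow-shift 1 (blocks-dominatesBelow a≢b k c t<))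

  γ≤-P[4+3k]×K : ∀ {a b} → a ≢ b → ∀ k → γ≤ (P (4 + k * 3) ×ᴳ K m) (4 + k * 2)
  γ≤-P[4+3k]×K {a} {b} a≢b k =
    subst (γ≤ _) (cong (2 +_) (trans (length-map (shift 2) B) (length-blocks a b k)))
      (γ≤-dominatesBelow ((1 , a) ∷ (1 , b) ∷ map (shift 2) B) below)
    where
      B = blocks a b (suc k)
      below : ∀ t c → t < 4 + k * 3 →
              DominatesBelow (4 + k * 3) ((1 , a) ∷ (1 , b) ∷ map (shift 2) B) (t , c)
      below 0 c _ with c ≟ a
      ... | yes refl = inj₂ ((1 , b) , there (here refl) , (inj₁ refl , a≢b) , s≤s (s≤s z≤n))
      ... | no c≢a   = inj₂ ((1 , a) , here refl , (inj₁ refl , c≢a) , s≤s (s≤s z≤n))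
      below 1 c _ with c ≟ a
      ... | yes refl = inj₁ (here refl)
      ... | no c≢a   = inj₂ ((2 , a) , there (there (here refl)) , (inj₁ refl , c≢a) ,
                             s≤s (s≤s (s≤s z≤n)))
      below (suc (suc t)) c (s≤s (s≤s t<)) =
        dominatesBelow-∷⁺ (dominatesBelow-∷⁺
          (dominatesBelow-shift 2 (blocks-dominatesBelow a≢b k c t<)))

proposition4p4 : (m n k : ℕ) → 3 ≤ m → 1 ≤ k →
    (n ≡ 3 * k → γ≤ (P n ×ᴳ K m) (2 * k + 1)) ×
    (n ≡ 3 * k + 1 → γ≤ (P n ×ᴳ K m) (2 * k + 2)) ×
    (n ≡ 3 * k + 2 → γ≤ (P n ×ᴳ K m) (2 * k + 2))
proposition4p4 m@(suc (suc (suc _))) n k@(suc j) (s≤s (s≤s (s≤s _))) (s≤s _) =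
    (λ n≡3k → resize (trans n≡3k (*-comm 3 k)) (d*k+r≡r+k*d 2 k 1)
                     (γ≤-P[3+3k]×K 0≢1 j))
  , (λ n≡3k+1 → resize (trans n≡3k+1 (d*k+r≡r+k*d 3 k 1)) (d*k+r≡r+k*d 2 k 2)
                       (γ≤-P[4+3k]×K 0≢1 j))
  , (λ n≡3k+2 → resize (trans n≡3k+2 (d*k+r≡r+k*d 3 k 2)) (d*k+r≡r+k*d 2 k 2)
                       (γ≤-P[2+3k]×K 0≢1 k))
  where
    0≢1 : fzero ≢ fsuc fzero
    0≢1 ()

    resize : ∀ {n n′ b b′} → n ≡ n′ → b ≡ b′ → γ≤ (P n′ ×ᴳ K m) b′ → γ≤ (P n ×ᴳ K m) b
    resize refl refl g = g
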